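{- Let $k\ge 4$ be an even integer, $n=2k$, $\mathcal{N}=\{0,1,\dots,n-1\}$, and let $A,B,C$ be the sets of elements of $\mathcal{N}$ congruent to $0,1,2$ modulo $3$, respectively. For $i\in\{0,1,2\}$ let $\mathcal{R}_i=\{R\in\binom{\mathcal{N}}{k}: \sum_{x\in R}x\equiv i \pmod 3\}$. Let $X$ be a $(k-1)$-subset of $\mathcal{N}$ with $A\not\subset X$, $B\not\subset X$ and $C\not\subset X$. If $\sum_{t\in\mathcal{N}}t\equiv j\pmod 3$, then $X\in\mathcal{D}(\mathcal{R}_i)$ for $i\equiv 2-j \pmod 3$ and for $i\equiv 4-j\pmod 3$.
   Context: $\binom{S}{j}$ is the family of all $j$-element subsets of a set $S$. For a family $\mathcal{F}$ of sets, $\mathcal{D}(\mathcal{F})=\{F\setminus F' : F,F'\in\mathcal{F}\}$. -}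

module Defs where

open import Data.Nat using (ℕ; _%_; _≡ᵇ_; _+_)
open import Data.Bool using (Bool; if_then_else_)
open import Data.Fin using (Fin; toℕ)
open import Data.Fin.Subset using (Subset; ∣_∣; _─_)
open import Data.Vec using (Vec; tabulate; lookup; allFin; foldr)
open import Data.Product using (∃₂; _×_)
open import Relation.Binary.PropositionalEquality using (_≡_)

subsetSum : ∀ {n} → Subset n → ℕ
subsetSum {n} S = foldr (λ _ → ℕ) (λ x acc → (if lookup S x then toℕ x else 0) + acc) 0 (allFin n)

residueClass : (n r : ℕ) → Subset n
residueClass n r = tabulate (λ x → toℕ x % 3 ≡ᵇ r)

InR : ∀ {n} (k i : ℕ) → Subset n → Set
InR k i R = (∣ R ∣ ≡ k) × (subsetSum R % 3 ≡ i % 3)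

InDR : ∀ {n} (k i : ℕ) → Subset n → Set
InDR {n} k i X = ∃₂ λ (F F' : Subset n) → InR k i F × InR k i F' × (F ─ F' ≡ X)

{-# OPTIONS --safe #-}

-- Pick a ∉ X and b ∉ X with a ≠ b and take F = X ∪ {a}, F' = ∁ (X ∪ {b}). Then F ∖ F' = X and
-- |F| = |F'| = k, while Σ F = Σ X + a and Σ F' = Σ 𝒩 − Σ X − b. So F, F' ∈ 𝓡_i as soon as
-- a ≡ i − Σ X and b ≡ j − i − Σ X (mod 3). Such a and b exist because no residue class lies
-- inside X, and they are distinct because the two residues differ exactly when i + j ≢ 0 (mod 3).
module Submission where

open import Defs
open import Data.Nat using (ℕ; _≤_; _*_; _+_; _∸_; _%_)
open import Data.Nat.Divisibility using (_∣_)
open import Data.Fin.Subset using (Subset; ∣_∣; _⊈_; ⊤)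
open import Data.Sum using (_⊎_)
open import Relation.Binary.PropositionalEquality using (_≡_)

open import Data.Bool using (Bool; true; false; if_then_else_; _∧_; _∨_)
open import Data.Bool.Properties using (T-≡; ∧-identityʳ; ∧-zeroʳ)
open import Data.Empty using (⊥-elim)
open import Data.Fin using (Fin; zero; suc; toℕ)
open import Data.Fin.Properties using (¬∀⟶∃¬)
open import Data.Fin.Subset using (_∈_; _∉_; _∪_; _∩_; _─_; ∁; ⁅_⁆) renaming (⊥ to ∅)
open import Data.Fin.Subset.Properties
  using (_∈?_; Empty-unique; x∈p∩q⁻; x∈⁅y⁆⇒x≡y; x≢y⇒x∉⁅y⁆; ∪-distribˡ-∩; ∪-identityʳ; ∪-inverseʳ;
         ∩-inverseʳ; ∣∁p∣≡n∸∣p∣)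
open import Data.Nat using (NonZero; zero; suc; s≤s)
open import Data.Nat.DivMod using (%-distribˡ-+; [m+kn]%n≡m%n; m%n<n)
open import Data.Nat.Properties using (+-comm; +-identityʳ; ≡ᵇ⇒≡; m+n∸m≡n; +-commutativeSemigroup)
open import Algebra.Properties.CommutativeSemigroup +-commutativeSemigroup using (interchange)
open import Data.Nat.Tactic.RingSolver using (solve-∀)
open import Data.Product using (∃; _×_; _,_)
open import Data.Sum using ([_,_])
open import Data.Vec using ([]; _∷_; lookup; tabulate; foldr; sum)
open import Data.Vec.Properties using (lookup∘tabulate; []=⇒lookup)
open import Function using (_∘_; id; const; case_of_; Equivalence)
open import Relation.Nullary.Decidable using (_→-dec_; decidable-stable)
open import Relation.Binary.PropositionalEquality
  using (_≢_; refl; sym; trans; cong; cong₂; subst; module ≡-Reasoning)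

open ≡-Reasoning

+-congˡ-mod : ∀ o m n {d} .{{_ : NonZero d}} → m % d ≡ n % d → (o + m) % d ≡ (o + n) % d
+-congˡ-mod o m n {d} m≡n = begin
  (o + m) % d            ≡⟨ %-distribˡ-+ o m d ⟩
  (o % d + m % d) % d    ≡⟨ cong (λ r → (o % d + r) % d) m≡n ⟩
  (o % d + n % d) % d    ≡⟨ %-distribˡ-+ o n d ⟨
  (o + n) % d            ∎

+-congʳ-mod : ∀ m n o {d} .{{_ : NonZero d}} → m % d ≡ n % d → (m + o) % d ≡ (n + o) % d
+-congʳ-mod m n o {d} m≡n = begin
  (m + o) % d   ≡⟨ cong (_% d) (+-comm m o) ⟩
  (o + m) % d   ≡⟨ +-congˡ-mod o m n m≡n ⟩
  (o + n) % d   ≡⟨ cong (_% d) (+-comm o n) ⟩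
  (n + o) % d   ∎

+-cancelʳ-mod : ∀ m n o {d} .{{_ : NonZero d}} → (m + o) % d ≡ (n + o) % d → m % d ≡ n % d
+-cancelʳ-mod m n o {suc d} m+o≡n+o = begin
  m % suc d                          ≡⟨ [m+kn]%n≡m%n m o (suc d) ⟨
  (m + o * suc d) % suc d            ≡⟨ cong (_% suc d) (shift m o d) ⟩
  (m + o + o * d) % suc d            ≡⟨ +-congʳ-mod (m + o) (n + o) (o * d) m+o≡n+o ⟩
  (n + o + o * d) % suc d            ≡⟨ cong (_% suc d) (shift n o d) ⟨
  (n + o * suc d) % suc d            ≡⟨ [m+kn]%n≡m%n n o (suc d) ⟩
  n % suc d                          ∎
  where
  shift : ∀ m o d → m + o * suc d ≡ m + o + o * d
  shift = solve-∀

-- Modulo 3, 2 * x stands for −x, so the congruences of the construction need no (truncated)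
-- subtraction.

a≡i-x⇒a+x≡i : ∀ a x i → a % 3 ≡ (i + 2 * x) % 3 → (a + x) % 3 ≡ i % 3
a≡i-x⇒a+x≡i a x i a≡i-x = begin
  (a + x) % 3          ≡⟨ +-congʳ-mod a (i + 2 * x) x a≡i-x ⟩
  (i + 2 * x + x) % 3  ≡⟨ cong (_% 3) (regroup i x) ⟩
  (i + x * 3) % 3      ≡⟨ [m+kn]%n≡m%n i x 3 ⟩
  i % 3                ∎
  where
  regroup : ∀ i x → i + 2 * x + x ≡ i + x * 3
  regroup = solve-∀

b≡j-i-x⇒s+b+x≡j⇒s≡i : ∀ s b x i j → b % 3 ≡ (j + 2 * (i + x)) % 3 →
                       (s + (b + x)) % 3 ≡ j % 3 → s % 3 ≡ i % 3
b≡j-i-x⇒s+b+x≡j⇒s≡i s b x i j b≡j-i-x s+b+x≡j = +-cancelʳ-mod s i (j + 2 * i) (begin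
  (s + (j + 2 * i)) % 3              ≡⟨ [m+kn]%n≡m%n (s + (j + 2 * i)) x 3 ⟨
  (s + (j + 2 * i) + x * 3) % 3      ≡⟨ cong (_% 3) (regroupˡ s x i j) ⟩
  (s + (j + 2 * (i + x) + x)) % 3
    ≡⟨ +-congˡ-mod s (b + x) _ (+-congʳ-mod b (j + 2 * (i + x)) x b≡j-i-x) ⟨
  (s + (b + x)) % 3                  ≡⟨ s+b+x≡j ⟩
  j % 3                              ≡⟨ [m+kn]%n≡m%n j i 3 ⟨
  (j + i * 3) % 3                    ≡⟨ cong (_% 3) (regroupʳ i j) ⟩
  (i + (j + 2 * i)) % 3              ∎)
  where
  regroupˡ : ∀ s x i j → s + (j + 2 * i) + x * 3 ≡ s + (j + 2 * (i + x) + x)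
  regroupˡ = solve-∀
  regroupʳ : ∀ i j → j + i * 3 ≡ i + (j + 2 * i)
  regroupʳ = solve-∀

i-x≡j-i-x⇒i+j≡0 : ∀ x i j → (i + 2 * x) % 3 ≡ (j + 2 * (i + x)) % 3 → (i + j) % 3 ≡ 0
i-x≡j-i-x⇒i+j≡0 x i j i-x≡j-i-x = sym (+-cancelʳ-mod 0 (i + j) (i + 2 * x) (begin
  (i + 2 * x) % 3              ≡⟨ i-x≡j-i-x ⟩
  (j + 2 * (i + x)) % 3        ≡⟨ cong (_% 3) (regroup x i j) ⟩
  (i + j + (i + 2 * x)) % 3    ∎))
  where
  regroup : ∀ x i j → j + 2 * (i + x) ≡ i + j + (i + 2 * x)
  regroup = solve-∀

weight : ∀ {n} → (Fin n → ℕ) → Subset n → ℕ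
weight w p = sum (tabulate λ x → if lookup p x then w x else 0)

foldr-+-tabulate : ∀ {m n} (f : Fin m → ℕ) (g : Fin n → Fin m) →
                   foldr (λ _ → ℕ) (λ x acc → f x + acc) 0 (tabulate g) ≡ sum (tabulate (f ∘ g))
foldr-+-tabulate {n = zero}  f g = refl
foldr-+-tabulate {n = suc n} f g = cong (f (g zero) +_) (foldr-+-tabulate f (g ∘ suc))

subsetSum≡weight : ∀ {n} (p : Subset n) → subsetSum p ≡ weight toℕ p
subsetSum≡weight p = foldr-+-tabulate (λ x → if lookup p x then toℕ x else 0) id

∣p∣≡weight1 : ∀ {n} (p : Subset n) → ∣ p ∣ ≡ weight (const 1) p
∣p∣≡weight1 []          = refl
∣p∣≡weight1 (true ∷ p)  = cong suc (∣p∣≡weight1 p)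
∣p∣≡weight1 (false ∷ p) = ∣p∣≡weight1 p

weight-∅ : ∀ {n} (w : Fin n → ℕ) → weight w ∅ ≡ 0
weight-∅ {zero}  w = refl
weight-∅ {suc n} w = weight-∅ (w ∘ suc)

weight-⁅⁆ : ∀ {n} (w : Fin n → ℕ) x → weight w ⁅ x ⁆ ≡ w x
weight-⁅⁆ w zero    = trans (cong (w zero +_) (weight-∅ (w ∘ suc))) (+-identityʳ (w zero))
weight-⁅⁆ w (suc x) = weight-⁅⁆ (w ∘ suc) x

weight-∪+weight-∩ : ∀ {n} (w : Fin n → ℕ) (p q : Subset n) →
                    weight w (p ∪ q) + weight w (p ∩ q) ≡ weight w p + weight w q
weight-∪+weight-∩ w []      []      = refl
weight-∪+weight-∩ w (s ∷ p) (t ∷ q) = begin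
  (at (s ∨ t) + weight w′ (p ∪ q)) + (at (s ∧ t) + weight w′ (p ∩ q))
    ≡⟨ interchange (at (s ∨ t)) _ (at (s ∧ t)) _ ⟩
  (at (s ∨ t) + at (s ∧ t)) + (weight w′ (p ∪ q) + weight w′ (p ∩ q))
    ≡⟨ cong₂ _+_ (at-∨+at-∧ s t) (weight-∪+weight-∩ w′ p q) ⟩
  (at s + at t) + (weight w′ p + weight w′ q)
    ≡⟨ interchange (at s) (at t) _ _ ⟩
  (at s + weight w′ p) + (at t + weight w′ q)
    ∎
  where
  w′ : Fin _ → ℕ
  w′ = w ∘ suc
  at : Bool → ℕ
  at b = if b then w zero else 0
  at-∨+at-∧ : ∀ s t → at (s ∨ t) + at (s ∧ t) ≡ at s + at t
  at-∨+at-∧ true  true  = refl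
  at-∨+at-∧ true  false = refl
  at-∨+at-∧ false true  = +-comm (w zero) 0
  at-∨+at-∧ false false = refl

x∉p⇒p∩⁅x⁆≡∅ : ∀ {n} {p : Subset n} {x} → x ∉ p → p ∩ ⁅ x ⁆ ≡ ∅
x∉p⇒p∩⁅x⁆≡∅ {p = p} {x} x∉p = Empty-unique λ (y , y∈p∩⁅x⁆) →
  let (y∈p , y∈⁅x⁆) = x∈p∩q⁻ p ⁅ x ⁆ y∈p∩⁅x⁆ in x∉p (subst (_∈ p) (x∈⁅y⁆⇒x≡y x y∈⁅x⁆) y∈p)

weight-∪⁅⁆ : ∀ {n} (w : Fin n → ℕ) {p : Subset n} {x} → x ∉ p →
             weight w (p ∪ ⁅ x ⁆) ≡ w x + weight w p
weight-∪⁅⁆ w {p} {x} x∉p = begin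
  weight w (p ∪ ⁅ x ⁆)                          ≡⟨ +-identityʳ _ ⟨
  weight w (p ∪ ⁅ x ⁆) + 0                      ≡⟨ cong (weight w (p ∪ ⁅ x ⁆) +_) weight-p∩⁅x⁆≡0 ⟨
  weight w (p ∪ ⁅ x ⁆) + weight w (p ∩ ⁅ x ⁆)   ≡⟨ weight-∪+weight-∩ w p ⁅ x ⁆ ⟩
  weight w p + weight w ⁅ x ⁆                   ≡⟨ cong (weight w p +_) (weight-⁅⁆ w x) ⟩
  weight w p + w x                              ≡⟨ +-comm (weight w p) (w x) ⟩
  w x + weight w p                              ∎
  where
  weight-p∩⁅x⁆≡0 : weight w (p ∩ ⁅ x ⁆) ≡ 0
  weight-p∩⁅x⁆≡0 = trans (cong (weight w) (x∉p⇒p∩⁅x⁆≡∅ x∉p)) (weight-∅ w)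

weight-∁+weight : ∀ {n} (w : Fin n → ℕ) (p : Subset n) → weight w (∁ p) + weight w p ≡ weight w ⊤
weight-∁+weight w p = begin
  weight w (∁ p) + weight w p               ≡⟨ +-comm (weight w (∁ p)) (weight w p) ⟩
  weight w p + weight w (∁ p)               ≡⟨ weight-∪+weight-∩ w p (∁ p) ⟨
  weight w (p ∪ ∁ p) + weight w (p ∩ ∁ p)   ≡⟨ cong₂ (λ q r → weight w q + weight w r)
                                                      (∪-inverseʳ p) (∩-inverseʳ p) ⟩
  weight w ⊤ + weight w ∅                   ≡⟨ cong (weight w ⊤ +_) (weight-∅ w) ⟩
  weight w ⊤ + 0                            ≡⟨ +-identityʳ _ ⟩
  weight w ⊤                                ∎

∣p∪⁅x⁆∣≡1+∣p∣ : ∀ {n} {p : Subset n} {x} → x ∉ p → ∣ p ∪ ⁅ x ⁆ ∣ ≡ suc ∣ p ∣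
∣p∪⁅x⁆∣≡1+∣p∣ {p = p} {x} x∉p = begin
  ∣ p ∪ ⁅ x ⁆ ∣                  ≡⟨ ∣p∣≡weight1 (p ∪ ⁅ x ⁆) ⟩
  weight (const 1) (p ∪ ⁅ x ⁆)   ≡⟨ weight-∪⁅⁆ (const 1) x∉p ⟩
  suc (weight (const 1) p)       ≡⟨ cong suc (∣p∣≡weight1 p) ⟨
  suc ∣ p ∣                      ∎

subsetSum-∪⁅⁆ : ∀ {n} {p : Subset n} {x} → x ∉ p → subsetSum (p ∪ ⁅ x ⁆) ≡ toℕ x + subsetSum p
subsetSum-∪⁅⁆ {p = p} {x} x∉p = begin
  subsetSum (p ∪ ⁅ x ⁆)     ≡⟨ subsetSum≡weight (p ∪ ⁅ x ⁆) ⟩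
  weight toℕ (p ∪ ⁅ x ⁆)    ≡⟨ weight-∪⁅⁆ toℕ x∉p ⟩
  toℕ x + weight toℕ p      ≡⟨ cong (toℕ x +_) (subsetSum≡weight p) ⟨
  toℕ x + subsetSum p       ∎

subsetSum-∁+subsetSum : ∀ {n} (p : Subset n) → subsetSum (∁ p) + subsetSum p ≡ subsetSum {n} ⊤
subsetSum-∁+subsetSum {n} p = begin
  subsetSum (∁ p) + subsetSum p     ≡⟨ cong₂ _+_ (subsetSum≡weight (∁ p)) (subsetSum≡weight p) ⟩
  weight toℕ (∁ p) + weight toℕ p   ≡⟨ weight-∁+weight toℕ p ⟩
  weight {n} toℕ ⊤                  ≡⟨ subsetSum≡weight {n} ⊤ ⟨
  subsetSum {n} ⊤                   ∎

subsetSum-∁[∪⁅⁆] : ∀ {n} {p : Subset n} {x} → x ∉ p →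
                   subsetSum (∁ (p ∪ ⁅ x ⁆)) + (toℕ x + subsetSum p) ≡ subsetSum {n} ⊤
subsetSum-∁[∪⁅⁆] {p = p} {x} x∉p =
  trans (cong (subsetSum (∁ (p ∪ ⁅ x ⁆)) +_) (sym (subsetSum-∪⁅⁆ x∉p)))
        (subsetSum-∁+subsetSum (p ∪ ⁅ x ⁆))

∣p∣≡k⇒∣∁p∣≡k : ∀ {k} (p : Subset (2 * k)) → ∣ p ∣ ≡ k → ∣ ∁ p ∣ ≡ k
∣p∣≡k⇒∣∁p∣≡k {k} p ∣p∣≡k = begin
  ∣ ∁ p ∣          ≡⟨ ∣∁p∣≡n∸∣p∣ p ⟩
  2 * k ∸ ∣ p ∣    ≡⟨ cong (2 * k ∸_) ∣p∣≡k ⟩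
  2 * k ∸ k        ≡⟨ m+n∸m≡n k (k + 0) ⟩
  k + 0            ≡⟨ +-identityʳ k ⟩
  k                ∎

p─∁q≡p∩q : ∀ {n} (p q : Subset n) → p ─ ∁ q ≡ p ∩ q
p─∁q≡p∩q []      []          = refl
p─∁q≡p∩q (s ∷ p) (true ∷ q)  = cong₂ _∷_ (sym (∧-identityʳ s)) (p─∁q≡p∩q p q)
p─∁q≡p∩q (s ∷ p) (false ∷ q) = cong₂ _∷_ (sym (∧-zeroʳ s)) (p─∁q≡p∩q p q)

p∪⁅x⁆─∁[p∪⁅y⁆]≡p : ∀ {n} (p : Subset n) {x y} → x ≢ y → (p ∪ ⁅ x ⁆) ─ ∁ (p ∪ ⁅ y ⁆) ≡ p
p∪⁅x⁆─∁[p∪⁅y⁆]≡p p {x} {y} x≢y = begin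
  (p ∪ ⁅ x ⁆) ─ ∁ (p ∪ ⁅ y ⁆)    ≡⟨ p─∁q≡p∩q (p ∪ ⁅ x ⁆) (p ∪ ⁅ y ⁆) ⟩
  (p ∪ ⁅ x ⁆) ∩ (p ∪ ⁅ y ⁆)      ≡⟨ ∪-distribˡ-∩ p ⁅ x ⁆ ⁅ y ⁆ ⟨
  p ∪ (⁅ x ⁆ ∩ ⁅ y ⁆)            ≡⟨ cong (p ∪_) (x∉p⇒p∩⁅x⁆≡∅ (x≢y⇒x∉⁅y⁆ (x≢y ∘ sym))) ⟩
  p ∪ ∅                          ≡⟨ ∪-identityʳ p ⟩
  p                              ∎

⊈⇒∃∈∉ : ∀ {n} {p q : Subset n} → p ⊈ q → ∃ λ x → x ∈ p × x ∉ q
⊈⇒∃∈∉ {n} {p} {q} p⊈q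
  with ¬∀⟶∃¬ n (λ x → x ∈ p → x ∈ q) (λ x → x ∈? p →-dec x ∈? q) (λ p⊆q → p⊈q (p⊆q _))
... | x , x∈p↛x∈q = x , decidable-stable (x ∈? p) (λ x∉p → x∈p↛x∈q (⊥-elim ∘ x∉p)) , x∈p↛x∈q ∘ const

∈residueClass⇒%3≡ : ∀ {n r} {x : Fin n} → x ∈ residueClass n r → toℕ x % 3 ≡ r
∈residueClass⇒%3≡ {x = x} x∈class =
  ≡ᵇ⇒≡ _ _ (Equivalence.from T-≡ (trans (sym (lookup∘tabulate _ x)) ([]=⇒lookup x∈class)))

residueClass⊈⇒∃∉ : ∀ {n r} {X : Subset n} → residueClass n r ⊈ X → ∃ λ a → a ∉ X × toℕ a % 3 ≡ r
residueClass⊈⇒∃∉ class⊈X with ⊈⇒∃∈∉ class⊈X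
... | a , a∈class , a∉X = a , a∉X , ∈residueClass⇒%3≡ a∈class

∃∉-of-every-residue : ∀ {n} {X : Subset n} →
                      residueClass n 0 ⊈ X → residueClass n 1 ⊈ X → residueClass n 2 ⊈ X →
                      ∀ m → ∃ λ a → a ∉ X × toℕ a % 3 ≡ m % 3
∃∉-of-every-residue A⊈X B⊈X C⊈X m with m % 3 | m%n<n m 3
... | 0 | _ = residueClass⊈⇒∃∉ A⊈X
... | 1 | _ = residueClass⊈⇒∃∉ B⊈X
... | 2 | _ = residueClass⊈⇒∃∉ C⊈X
... | suc (suc (suc _)) | s≤s (s≤s (s≤s ()))

lemma2p1 : (k : ℕ) → 4 ≤ k → 2 ∣ k → (X : Subset (2 * k)) → ∣ X ∣ ≡ k ∸ 1 →
    residueClass (2 * k) 0 ⊈ X → residueClass (2 * k) 1 ⊈ X → residueClass (2 * k) 2 ⊈ X →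
    (j i : ℕ) → subsetSum {2 * k} ⊤ % 3 ≡ j % 3 →
    ((i + j) % 3 ≡ 2 ⊎ (i + j) % 3 ≡ 1) → InDR k i X
lemma2p1 (suc k) (s≤s _) _ X ∣X∣≡k A⊈X B⊈X C⊈X j i ΣN≡j i+j≡2⊎1
  with ∃∉-of-every-residue A⊈X B⊈X C⊈X (i + 2 * subsetSum X)
     | ∃∉-of-every-residue A⊈X B⊈X C⊈X (j + 2 * (i + subsetSum X))
... | a , a∉X , a≡i-x | b , b∉X , b≡j-i-x =
  X ∪ ⁅ a ⁆ , ∁ (X ∪ ⁅ b ⁆)
  , (∣X∪⁅⁆∣≡1+k a∉X , ΣF≡i)
  , (∣p∣≡k⇒∣∁p∣≡k (X ∪ ⁅ b ⁆) (∣X∪⁅⁆∣≡1+k b∉X) , ΣF′≡i)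
  , p∪⁅x⁆─∁[p∪⁅y⁆]≡p X a≢b
  where
  x : ℕ
  x = subsetSum X
  ∣X∪⁅⁆∣≡1+k : ∀ {c} → c ∉ X → ∣ X ∪ ⁅ c ⁆ ∣ ≡ suc k
  ∣X∪⁅⁆∣≡1+k c∉X = trans (∣p∪⁅x⁆∣≡1+∣p∣ c∉X) (cong suc ∣X∣≡k)
  ΣF≡i : subsetSum (X ∪ ⁅ a ⁆) % 3 ≡ i % 3
  ΣF≡i = trans (cong (_% 3) (subsetSum-∪⁅⁆ a∉X)) (a≡i-x⇒a+x≡i (toℕ a) x i a≡i-x)
  ΣF′≡i : subsetSum (∁ (X ∪ ⁅ b ⁆)) % 3 ≡ i % 3
  ΣF′≡i = b≡j-i-x⇒s+b+x≡j⇒s≡i (subsetSum (∁ (X ∪ ⁅ b ⁆))) (toℕ b) x i j b≡j-i-x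
            (trans (cong (_% 3) (subsetSum-∁[∪⁅⁆] b∉X)) ΣN≡j)
  a≢b : a ≢ b
  a≢b a≡b = i+j≢0 (i-x≡j-i-x⇒i+j≡0 x i j
                     (trans (sym a≡i-x) (trans (cong (λ c → toℕ c % 3) a≡b) b≡j-i-x)))
    where
    i+j≢0 : (i + j) % 3 ≢ 0
    i+j≢0 i+j≡0 = [ (λ i+j≡2 → case trans (sym i+j≡2) i+j≡0 of λ ())
                  , (λ i+j≡1 → case trans (sym i+j≡1) i+j≡0 of λ ()) ] i+j≡2⊎1
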